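{- There are infinitely many pairs $(b,y)$ of integers with $b\ge 2$, $y\ge 1$, for which there exists a word $w$ over $\{0,1,\dots,b-1\}$ with $|w|=1$ such that $(y^3)_b = w\uparrow 3$; equivalently, infinitely many positive integer solutions $(b,y,c)$ of $y^3=c(b^2+b+1)$ with $1\le c<b$.
   Context: $(m)_b$ denotes the canonical base-$b$ representation of the integer $m$ (no leading zeros); $|w|$ is the length of the word $w$ and $w\uparrow n$ is the concatenation of $n$ copies of $w$. -}

module Defs where

open import Data.Nat using (ℕ; zero; suc; _+_; _*_; _^_; _<_; _≤_; _%_; _/_)
open import Data.Nat.Induction using (<-wellFounded)
open import Data.List using (List; []; _∷_; _++_; reverse; length)
open import Data.Fin using (Fin; fromℕ<)
open import Data.Nat.DivMod using (m%n<n; m/n<m)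
open import Induction.WellFounded using (Acc; acc)

-- Digits of m in base b, least significant first, with no leading zeros
-- (so (0)_b is the empty word). b ≥ 2 is passed as a proof.
digitsLE : (b : ℕ) → 2 ≤ b → (m : ℕ) → Acc _<_ m → List (Fin b)
digitsLE b h zero _ = []
digitsLE b h@(Data.Nat.s≤s (Data.Nat.s≤s _)) (suc m) (acc rs) =
  fromℕ< (m%n<n (suc m) b)
    ∷ digitsLE b h (suc m / b) (rs (m/n<m (suc m) b h))

repr : (b : ℕ) → 2 ≤ b → ℕ → List (Fin b)
repr b h m = reverse (digitsLE b h m (<-wellFounded m))

_↑_ : {A : Set} → List A → ℕ → List A
w ↑ zero = []
w ↑ suc n = w ++ (w ↑ n)

{-# OPTIONS --safe #-}
-- If x² + x + 1 = 343 y² with 1 ≤ y < x, then (7y)³ = y (x² + x + 1) is written y y y in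
-- base x. The equation says that (2x + 1) + 2y√343 has norm −3; multiplying by a unit
-- (2h + 1) + 2q√343 of norm 1 preserves this and increases x, so iterating from the
-- solution (18, 1) gives infinitely many bases.
module Submission where

open import Defs
open import Data.Nat using (ℕ; zero; suc; _+_; _*_; _^_; _%_; _/_; _<_; _≤_; s≤s; z≤n; NonZero)
open import Data.Nat.Properties
open import Data.Nat.DivMod
open import Data.Nat.Divisibility using (divides-refl)
open import Data.Nat.Induction using (<-wellFounded)
open import Data.Nat.Tactic.RingSolver using (solve-∀)
open import Data.Fin using (Fin; fromℕ<)
open import Data.Fin.Properties using (fromℕ<-cong)
open import Data.List using (List; []; _∷_; _++_; length; reverse)
open import Data.List.Properties using (++-assoc; ++-identityʳ; reverse-++)
open import Data.Product using (Σ; _×_; _,_)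
open import Data.Sum using (inj₁; inj₂)
open import Induction.WellFounded using (Acc; acc)
open import Relation.Nullary using (contradiction)
open import Relation.Binary.PropositionalEquality
  using (_≡_; refl; sym; trans; cong; cong₂; subst₂; module ≡-Reasoning)

↑-++-comm : ∀ {A : Set} (w : List A) n → w ↑ n ++ w ≡ w ++ w ↑ n
↑-++-comm w zero = sym (++-identityʳ w)
↑-++-comm w (suc n) = begin
  (w ++ w ↑ n) ++ w  ≡⟨ ++-assoc w (w ↑ n) w ⟩
  w ++ (w ↑ n ++ w)  ≡⟨ cong (w ++_) (↑-++-comm w n) ⟩
  w ++ (w ++ w ↑ n)  ∎
  where open ≡-Reasoning

reverse-↑ : ∀ {A : Set} (w : List A) n → reverse (w ↑ n) ≡ reverse w ↑ n
reverse-↑ w zero = refl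
reverse-↑ w (suc n) = begin
  reverse (w ++ w ↑ n)               ≡⟨ reverse-++ w (w ↑ n) ⟩
  reverse (w ↑ n) ++ reverse w       ≡⟨ cong (_++ reverse w) (reverse-↑ w n) ⟩
  reverse w ↑ n ++ reverse w         ≡⟨ ↑-++-comm (reverse w) n ⟩
  reverse w ++ reverse w ↑ n         ∎
  where open ≡-Reasoning

digitsLE-cong : ∀ {b} (hb : 2 ≤ b) {m n} → m ≡ n → (a : Acc _<_ m) (a′ : Acc _<_ n) →
                digitsLE b hb m a ≡ digitsLE b hb n a′
digitsLE-cong hb {zero} refl a a′ = refl
digitsLE-cong hb@(s≤s (s≤s _)) {suc m} refl (acc rs) (acc rs′) =
  cong (_ ∷_) (digitsLE-cong hb refl (rs _) (rs′ _))

m<n⇒[m+kn]%n≡m : ∀ {m n} k .{{_ : NonZero n}} → m < n → (m + k * n) % n ≡ m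
m<n⇒[m+kn]%n≡m {m} {n} k m<n = trans ([m+kn]%n≡m%n m k n) (m<n⇒m%n≡m m<n)

m<n⇒[m+kn]/n≡k : ∀ {m n} k .{{_ : NonZero n}} → m < n → (m + k * n) / n ≡ k
m<n⇒[m+kn]/n≡k {m} {n} k m<n = begin
  (m + k * n) / n    ≡⟨ +-distrib-/-∣ʳ m (divides-refl k) ⟩
  m / n + k * n / n  ≡⟨ cong₂ _+_ (m<n⇒m/n≡0 m<n) (m*n/n≡m k n) ⟩
  k                  ∎
  where open ≡-Reasoning

digitsLE-digit+ : ∀ {b} (hb : 2 ≤ b) {c} k → 1 ≤ c → (c<b : c < b) (a : Acc _<_ (c + k * b)) →
                  digitsLE b hb (c + k * b) a ≡ fromℕ< c<b ∷ digitsLE b hb k (<-wellFounded k)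
digitsLE-digit+ hb@(s≤s (s≤s _)) {suc c} k (s≤s z≤n) c<b (acc rs) =
  cong₂ _∷_ (fromℕ<-cong _ _ (m<n⇒[m+kn]%n≡m k c<b) (m%n<n (suc c + k * _) _) c<b)
            (digitsLE-cong hb (m<n⇒[m+kn]/n≡k k c<b) (rs _) (<-wellFounded k))

repunit : ℕ → ℕ → ℕ
repunit b zero = 0
repunit b (suc n) = 1 + repunit b n * b

digitsLE-repdigit : ∀ {b} (hb : 2 ≤ b) {c} n → 1 ≤ c → (c<b : c < b) →
                    digitsLE b hb (c * repunit b n) (<-wellFounded _) ≡ (fromℕ< c<b ∷ []) ↑ n
digitsLE-repdigit hb {c} zero 1≤c c<b = digitsLE-cong hb (*-zeroʳ c) _ (<-wellFounded 0)
digitsLE-repdigit {b} hb {c} (suc n) 1≤c c<b = begin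
  digitsLE b hb (c * (1 + r * b)) _       ≡⟨ digitsLE-cong hb (shift c r b) _ (<-wellFounded _) ⟩
  digitsLE b hb (c + c * r * b) _         ≡⟨ digitsLE-digit+ hb (c * r) 1≤c c<b _ ⟩
  fromℕ< c<b ∷ digitsLE b hb (c * r) _    ≡⟨ cong (fromℕ< c<b ∷_) (digitsLE-repdigit hb n 1≤c c<b) ⟩
  fromℕ< c<b ∷ (fromℕ< c<b ∷ []) ↑ n      ∎
  where
  open ≡-Reasoning
  r = repunit b n
  shift : ∀ c r b → c * (1 + r * b) ≡ c + c * r * b
  shift = solve-∀

repr-repdigit : ∀ {b} (hb : 2 ≤ b) {c} n → 1 ≤ c → (c<b : c < b) →
                repr b hb (c * repunit b n) ≡ (fromℕ< c<b ∷ []) ↑ n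
repr-repdigit {b} hb {c} n 1≤c c<b = begin
  repr b hb (c * repunit b n)                  ≡⟨ cong reverse (digitsLE-repdigit hb n 1≤c c<b) ⟩
  reverse ((fromℕ< c<b ∷ []) ↑ n)              ≡⟨ reverse-↑ (fromℕ< c<b ∷ []) n ⟩
  (fromℕ< c<b ∷ []) ↑ n                        ∎
  where open ≡-Reasoning

record PellSolution (d : ℕ) : Set where
  field
    x y : ℕ
    x²+x+1≡dy² : x * x + x + 1 ≡ d * (y * y)

open PellSolution

-- Multiplicativity of the norm in ℤ[√d] applied to (2x + 1) + 2y√d and (2h + 1) + 2q√d,
-- with the negative terms moved across so that it is a semiring identity.
pell-composition-identity : ∀ d h q x y →
  (x + 2 * h * x + h + 2 * d * q * y) * (x + 2 * h * x + h + 2 * d * q * y)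
    + (x + 2 * h * x + h + 2 * d * q * y) + 1
    + (4 * (x * x + x + 1) * (d * (q * q)) + 4 * (d * (y * y)) * (h * h + h)
       + d * (y * y) + 3 * (h * h + h))
  ≡ d * ((y + q * (2 * x + 1) + 2 * h * y) * (y + q * (2 * x + 1) + 2 * h * y))
    + (4 * (x * x + x + 1) * (h * h + h) + 4 * (d * (y * y)) * (d * (q * q))
       + (x * x + x + 1) + 3 * (d * (q * q)))
pell-composition-identity = solve-∀

record PellUnit (d : ℕ) : Set where
  field
    h q : ℕ
    h²+h≡dq² : h * h + h ≡ d * (q * q)

open PellUnit

compose : ∀ {d} → PellUnit d → PellSolution d → PellSolution d
compose {d} u s = record
  { x = x′
  ; y = y′
  ; x²+x+1≡dy² = +-cancelʳ-≡ _ _ _ (subst₂ balanced (x²+x+1≡dy² s) (h²+h≡dq² u)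
                   (pell-composition-identity d (h u) (q u) (x s) (y s)))
  }
  where
  x′ = x s + 2 * h u * x s + h u + 2 * d * q u * y s
  y′ = y s + q u * (2 * x s + 1) + 2 * h u * y s
  β = d * (y s * y s)
  δ = d * (q u * q u)
  balanced : ℕ → ℕ → Set
  balanced α γ = x′ * x′ + x′ + 1 + (4 * α * δ + 4 * β * γ + β + 3 * γ)
               ≡ d * (y′ * y′) + (4 * α * γ + 4 * β * δ + α + 3 * δ)

pell-y-positive : ∀ {d x y} → x * x + x + 1 ≡ d * (y * y) → 1 ≤ y
pell-y-positive {d} {x} {zero} eq = contradiction (trans eq (*-zeroʳ d)) (m+1+n≢0 (x * x + x))
pell-y-positive {y = suc _} eq = s≤s z≤n

pell-y<x : ∀ {d x y} → 4 ≤ d → x * x + x + 1 ≡ d * (y * y) → y < x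
pell-y<x {d} {x} {zero} 4≤d eq = contradiction (pell-y-positive {d} {x} {0} eq) λ ()
pell-y<x {d} {x} {y@(suc _)} 4≤d eq with <-≤-connex y x
... | inj₁ y<x = y<x
... | inj₂ x≤y = contradiction dy²<dy² (<-irrefl refl)
  where
  open ≤-Reasoning
  triple : ∀ n → n + n + n ≡ 3 * n
  triple = solve-∀
  dy²<dy² : d * (y * y) < d * (y * y)
  dy²<dy² = begin-strict
    d * (y * y)          ≡⟨ sym eq ⟩
    x * x + x + 1        ≤⟨ +-mono-≤ (+-mono-≤ (*-mono-≤ x≤y x≤y) (≤-trans x≤y (m≤m*n y y))) (s≤s z≤n) ⟩
    y * y + y * y + y * y ≡⟨ triple (y * y) ⟩
    3 * (y * y)          <⟨ *-monoˡ-< (y * y) (n<1+n 3) ⟩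
    4 * (y * y)          ≤⟨ *-monoˡ-≤ (y * y) 4≤d ⟩
    d * (y * y)          ∎

compose-increasing : ∀ {d} (u : PellUnit d) → 1 ≤ h u → (s : PellSolution d) → x s < x (compose u s)
compose-increasing u 1≤h s =
  ≤-trans (m<m+n (x s) 1≤h) (≤-trans (+-monoˡ-≤ (h u) (m≤m+n (x s) _)) (m≤m+n _ _))

-- (2h + 1, q) is the fundamental solution of u² − 1372 v² = 1.
unit₃₄₃ : PellUnit 343
unit₃₄₃ = record { h = 17050177433963583 ; q = 920623046934552 ; h²+h≡dq² = refl }

solution : ℕ → PellSolution 343
solution zero = record { x = 18 ; y = 1 ; x²+x+1≡dy² = refl }
solution (suc n) = compose unit₃₄₃ (solution n)

n<x[solution] : ∀ n → n < x (solution n)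
n<x[solution] zero = s≤s z≤n
n<x[solution] (suc n) = ≤-trans (s≤s (n<x[solution] n)) (compose-increasing unit₃₄₃ (s≤s z≤n) (solution n))

cube-repdigit : ∀ {m b t} → b * b + b + 1 ≡ m ^ 3 * (t * t) → (m * t) ^ 3 ≡ t * repunit b 3
cube-repdigit {m} {b} {t} eq = begin
  (m * t) ^ 3                ≡⟨ cube-split m t ⟩
  t * (m ^ 3 * (t * t))      ≡⟨ cong (t *_) (sym eq) ⟩
  t * (b * b + b + 1)        ≡⟨ cong (t *_) (repunit-3 b) ⟩
  t * repunit b 3            ∎
  where
  open ≡-Reasoning
  -- _^_ and repunit appear unfolded because solve-∀ does not unfold definitions.
  cube-split : ∀ m t → m * t * (m * t * (m * t * 1)) ≡ t * (m * (m * (m * 1)) * (t * t))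
  cube-split = solve-∀
  repunit-3 : ∀ b → b * b + b + 1 ≡ 1 + (1 + (1 + 0 * b) * b) * b
  repunit-3 = solve-∀

mainTheorem11 : ∀ (N : ℕ) → Σ ℕ λ b → Σ ℕ λ y → N < b + y × Σ (2 ≤ b) λ hb → 1 ≤ y
    × Σ (List (Fin b)) λ w → length w ≡ 1 × repr b hb (y ^ 3) ≡ w ↑ 3
mainTheorem11 N = b , 7 * t , ≤-trans (n<x[solution] N) (m≤m+n b _)
                , hb , ≤-trans 1≤t (m≤m+n t _)
                , fromℕ< t<b ∷ [] , refl , digits
  where
  s = solution N
  b = x s
  t = y s
  1≤t : 1 ≤ t
  1≤t = pell-y-positive {343} {b} {t} (x²+x+1≡dy² s)
  t<b : t < b
  t<b = pell-y<x {343} {b} {t} (m≤m+n 4 339) (x²+x+1≡dy² s)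
  hb : 2 ≤ b
  hb = ≤-trans (s≤s 1≤t) t<b
  digits : repr b hb ((7 * t) ^ 3) ≡ (fromℕ< t<b ∷ []) ↑ 3
  digits = trans (cong (repr b hb) (cube-repdigit {7} {b} {t} (x²+x+1≡dy² s))) (repr-repdigit hb 3 1≤t t<b)
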